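{- Let $\mathcal{P}\subset\mathbb{R}^N$ be a lattice polytope. Then for every integer $n\ge\dim(\mathcal{P})$ (with $n\geq 1$), the polytope $n\mathcal{P}$ is $2$-convex-normal.
   Context: A lattice polytope is a convex polytope with vertices in $\mathbb{Z}^N$; $n\mathcal{P}=\{n\mathbf{x}:\mathbf{x}\in\mathcal{P}\}$. A lattice polytope $\mathcal{Q}\subset\mathbb{R}^N$ is $2$-convex-normal if $2\mathcal{Q}=(\mathcal{Q}\cap\mathbb{Z}^N)+\mathcal{Q}$ (Minkowski sum).
   Formalization: Points have rational coordinates, ℚ^N in place of ℝ^N, so the polytopes $\mathcal{P}$ and $n\mathcal{P}$, the Minkowski sum, and the affinely independent families bounding $\dim(\mathcal{P})$ consist of rational points. -}

module Defs where

open import Data.Nat using (ℕ; zero; suc)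
import Data.Nat as ℕ
open import Data.Integer using (ℤ; +_)
open import Data.Rational using (ℚ; 0ℚ; 1ℚ; _+_; _*_; _≤_; _/_)
open import Data.Fin using (Fin; zero; suc)
open import Data.Product using (Σ; _×_; ∃)
open import Relation.Binary.PropositionalEquality using (_≡_)

-- Points of ℚ^N (rational points of ℝ^N), and lattice points ℤ^N.
Pt : ℕ → Set
Pt N = Fin N → ℚ

LPt : ℕ → Set
LPt N = Fin N → ℤ

emb : ∀ {N} → LPt N → Pt N
emb z j = z j / 1

nat : ℕ → ℚ
nat n = + n / 1

Σℚ : ∀ {k} → (Fin k → ℚ) → ℚ
Σℚ {zero} f = 0ℚ
Σℚ {suc k} f = f zero + Σℚ (λ i → f (suc i))

lincomb : ∀ {N k} → (Fin k → ℚ) → (Fin k → Pt N) → Pt N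
lincomb c p j = Σℚ (λ i → c i * p i j)

_⊕_ : ∀ {N} → Pt N → Pt N → Pt N
(x ⊕ y) j = x j + y j

_•_ : ∀ {N} → ℚ → Pt N → Pt N
(a • x) j = a * x j

_≈_ : ∀ {N} → Pt N → Pt N → Set
x ≈ y = ∀ j → x j ≡ y j

PSet : ℕ → Set₁
PSet N = Pt N → Set

ConvHull : ∀ {N m} → (Fin m → Pt N) → PSet N
ConvHull {N} {m} v x =
  Σ (Fin m → ℚ) λ c → (∀ i → 0ℚ ≤ c i) × (Σℚ c ≡ 1ℚ) × (x ≈ lincomb c v)

LatticePolytope : ∀ {N m} → (Fin m → LPt N) → PSet N
LatticePolytope v = ConvHull (λ i → emb (v i))

dilate : ∀ {N} → ℕ → PSet N → PSet N
dilate k S x = Σ (Pt _) λ y → S y × (x ≈ (nat k • y))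

Mink : ∀ {N} → PSet N → PSet N → PSet N
Mink A B x = Σ (Pt _) λ a → Σ (Pt _) λ b → A a × B b × (x ≈ (a ⊕ b))

latticePts : ∀ {N} → PSet N → PSet N
latticePts S x = Σ (LPt _) λ z → S (emb z) × (x ≈ emb z)

TwoConvexNormal : ∀ {N} → PSet N → Set
TwoConvexNormal Q =
  (∀ x → dilate 2 Q x → Mink (latticePts Q) Q x) ×
  (∀ x → Mink (latticePts Q) Q x → dilate 2 Q x)

AffIndep : ∀ {N k} → (Fin k → Pt N) → Set
AffIndep {N} {k} p =
  ∀ (c : Fin k → ℚ) → Σℚ c ≡ 0ℚ → lincomb c p ≈ (λ _ → 0ℚ) → ∀ i → c i ≡ 0ℚ

-- dim S ≤ n : every affinely independent family of points of S has
-- at most n+1 members (dim = max size of aff. indep. family − 1)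
DimLE : ∀ {N} → PSet N → ℕ → Set
DimLE {N} S n =
  ∀ k (p : Fin (suc k) → Pt N) → (∀ i → S (p i)) → AffIndep p → k ℕ.≤ n

module Submission where

-- By Carathéodory's theorem a point y of P is a convex combination Σ cᵢ vᵢ of k + 1 vertices
-- with k ≤ n: while the vertices used are more than n + 1, the dimension bound makes them
-- affinely dependent and one of them can be dropped. Put αᵢ = 2n cᵢ, so that 2n y = Σ αᵢ vᵢ and
-- Σ αᵢ = 2n ≥ n + k. Rounding the αᵢ down yields naturals aᵢ ≤ αᵢ with Σ aᵢ = n; then
-- 2n y = Σ aᵢ vᵢ + Σ (αᵢ − aᵢ) vᵢ, where the first summand is a lattice point of nP and the second
-- lies in nP. Conversely, a sum of two points of nP is 2n times the midpoint of two points of P.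

open import Defs
open import Data.Nat using (ℕ; _≤_; zero; suc)
open import Data.Fin using (Fin; zero; suc; punchIn)

import Data.Nat as ℕ
import Data.Nat.Properties as ℕP
import Data.Nat.DivMod as ℕD
import Data.Nat.Coprimality as Coprime
open import Data.Integer as ℤ using (ℤ; -[1+_])
import Data.Integer.Properties as ℤP
open import Data.Rational as ℚ using (ℚ; mkℚ; 0ℚ; 1ℚ; ½; _+_; _*_; _-_; -_; _/_; _÷_; *≤*; *<*)
import Data.Rational.Properties as ℚP
open import Data.Rational.Solver using (module +-*-Solver)
import Data.Fin as Fin
import Data.Fin.Properties as FinP
open import Data.Vec.Functional using (removeAt; insertAt; tail; _∷_; [])
open import Data.Vec.Functional.Properties using (insertAt-lookup; insertAt-punchIn)
open import Data.Product using (Σ; _×_; _,_; proj₁; proj₂)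
open import Data.Sum as Sum using (_⊎_; inj₁; inj₂)
open import Data.Empty using (⊥-elim)
open import Function using (_∘_; id)
open import Relation.Nullary using (yes; no; ¬_)
open import Relation.Nullary.Decidable using (decidable-stable)
open import Relation.Unary using (Decidable)
open import Relation.Binary.Definitions using (tri<; tri≈; tri>)
open import Relation.Binary.PropositionalEquality
open import Algebra.Bundles using (Ring)
import Algebra.Properties.Semiring.Sum as SemiringSum
open import Algebra.Properties.Group ℚP.+-0-group using (inverseˡ-unique)
open import Algebra.Apartness.Properties.HeytingCommutativeRing ℚP.heytingCommutativeRing
  using (x#0y#0→xy#0)

open +-*-Solver

-- Arithmetic in ℚ

*-nonNeg : ∀ {p q} → 0ℚ ℚ.≤ p → 0ℚ ℚ.≤ q → 0ℚ ℚ.≤ p * q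
*-nonNeg {p} {q} p≥0 q≥0 = ℚP.nonNegative⁻¹ (p * q)
  {{ℚP.nonNeg*nonNeg⇒nonNeg p {{ℚ.nonNegative p≥0}} q {{ℚ.nonNegative q≥0}}}}

p≤q⇒0≤q-p : ∀ {p q} → p ℚ.≤ q → 0ℚ ℚ.≤ q - p
p≤q⇒0≤q-p {p} {q} p≤q = subst (ℚ._≤ q - p) (ℚP.+-inverseʳ p) (ℚP.+-monoˡ-≤ (- p) p≤q)

x*y≡0⇒x≡0 : ∀ {x y} → y ≢ 0ℚ → x * y ≡ 0ℚ → x ≡ 0ℚ
x*y≡0⇒x≡0 {x} y≢0 xy≡0 = decidable-stable (x ℚP.≟ 0ℚ) (λ x≢0 → x#0y#0→xy#0 x≢0 y≢0 xy≡0)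

ratio : ∀ (p q : ℚ) → .(0ℚ ℚ.< q) → ℚ
ratio p q q>0 = (p ÷ q) {{ℚP.pos⇒nonZero q {{ℚ.positive q>0}}}}

ratio-* : ∀ p q .(q>0 : 0ℚ ℚ.< q) → ratio p q q>0 * q ≡ p
ratio-* p q q>0 = begin
  p * 1/q * q     ≡⟨ ℚP.*-assoc p 1/q q ⟩
  p * (1/q * q)   ≡⟨ cong (p *_) (ℚP.*-inverseˡ q {{nonZero}}) ⟩
  p * 1ℚ          ≡⟨ ℚP.*-identityʳ p ⟩
  p               ∎
  where
  open ≡-Reasoning
  nonZero = ℚP.pos⇒nonZero q {{ℚ.positive q>0}}
  1/q = (ℚ.1/ q) {{nonZero}}

ratio-nonNeg : ∀ {p q} → 0ℚ ℚ.≤ p → (q>0 : 0ℚ ℚ.< q) → 0ℚ ℚ.≤ ratio p q q>0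
ratio-nonNeg {p} {q} p≥0 q>0 = ℚP.*-cancelʳ-≤-pos q {{ℚ.positive q>0}}
  (subst₂ ℚ._≤_ (sym (ℚP.*-zeroˡ q)) (sym (ratio-* p q q>0)) p≥0)

/1≡mkℚ : ∀ z → z / 1 ≡ mkℚ z 0 (Coprime.sym (Coprime.1-coprimeTo _))
/1≡mkℚ z = ℚP.↥p/↧p≡p _

/1-homo-+ : ∀ a b → (a ℤ.+ b) / 1 ≡ a / 1 + b / 1
/1-homo-+ a b rewrite /1≡mkℚ a | /1≡mkℚ b | ℤP.*-identityʳ a | ℤP.*-identityʳ b = refl

/1-homo-* : ∀ a b → (a ℤ.* b) / 1 ≡ a / 1 * (b / 1)
/1-homo-* a b rewrite /1≡mkℚ a | /1≡mkℚ b = refl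

/1-mono-≤ : ∀ {a b} → a ℤ.≤ b → a / 1 ℚ.≤ b / 1
/1-mono-≤ {a} {b} a≤b rewrite /1≡mkℚ a | /1≡mkℚ b =
  *≤* (subst₂ ℤ._≤_ (sym (ℤP.*-identityʳ a)) (sym (ℤP.*-identityʳ b)) a≤b)

/1-cancel-< : ∀ {a b} → a / 1 ℚ.< b / 1 → a ℤ.< b
/1-cancel-< {a} {b} a<b rewrite /1≡mkℚ a | /1≡mkℚ b with a<b
... | *<* a*1<b*1 = subst₂ ℤ._<_ (ℤP.*-identityʳ a) (ℤP.*-identityʳ b) a*1<b*1

nat-homo-+ : ∀ m n → nat (m ℕ.+ n) ≡ nat m + nat n
nat-homo-+ m n = /1-homo-+ (ℤ.+ m) (ℤ.+ n)

nat-mono-≤ : ∀ {m n} → m ≤ n → nat m ℚ.≤ nat n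
nat-mono-≤ m≤n = /1-mono-≤ (ℤ.+≤+ m≤n)

nat-nonNeg : ∀ n → 0ℚ ℚ.≤ nat n
nat-nonNeg n = nat-mono-≤ {0} {n} ℕ.z≤n

nat-cancel-< : ∀ {m n} → nat m ℚ.< nat n → m ℕ.< n
nat-cancel-< {m} {n} = ℤP.drop‿+<+ ∘ /1-cancel-< {ℤ.+ m} {ℤ.+ n}

nat-floor : ∀ q → 0ℚ ℚ.≤ q → Σ ℕ λ f → nat f ℚ.≤ q × q ℚ.< nat (suc f)
nat-floor (mkℚ -[1+ _ ] _ _) (*≤* ())
nat-floor (mkℚ (ℤ.+ a) d _) _ = f , f≤q , q<1+f
  where
  f = a ℕD./ suc d
  a≡a*1 : ℤ.+ a ≡ ℤ.+ a ℤ.* ℤ.+ 1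
  a≡a*1 = sym (ℤP.*-identityʳ (ℤ.+ a))
  f≤q : nat f ℚ.≤ mkℚ (ℤ.+ a) d _
  f≤q rewrite /1≡mkℚ (ℤ.+ f) =
    *≤* (subst₂ ℤ._≤_ (ℤP.pos-* f (suc d)) a≡a*1 (ℤ.+≤+ (ℕD.m/n*n≤m a (suc d))))
  a<[1+f]*[1+d] : a ℕ.< suc f ℕ.* suc d
  a<[1+f]*[1+d] = ℕP.≤-<-trans (ℕP.≤-reflexive (ℕD.m≡m%n+[m/n]*n a (suc d)))
                    (ℕP.+-monoˡ-< (f ℕ.* suc d) (ℕD.m%n<n a (suc d)))
  q<1+f : mkℚ (ℤ.+ a) d _ ℚ.< nat (suc f)
  q<1+f rewrite /1≡mkℚ (ℤ.+ suc f) =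
    *<* (subst₂ ℤ._<_ a≡a*1 (ℤP.pos-* (suc f) (suc d)) (ℤ.+<+ a<[1+f]*[1+d]))

-- Finite sums

punchIn-cover : ∀ {k} {P : Fin (suc k) → Set} j → P j → (∀ i → P (punchIn j i)) → ∀ x → P x
punchIn-cover {P = P} j Pj Pπ x with x Fin.≟ j
... | yes refl = Pj
... | no x≢j = subst P (FinP.punchIn-punchOut (x≢j ∘ sym)) (Pπ _)

module ℚΣ = SemiringSum (Ring.semiring ℚP.+-*-ring)

Σℚ≡sum : ∀ {k} (f : Fin k → ℚ) → Σℚ f ≡ ℚΣ.sum f
Σℚ≡sum {zero} f = refl
Σℚ≡sum {suc k} f = cong (f zero +_) (Σℚ≡sum (f ∘ suc))

Σℚ-cong : ∀ {k} {f g : Fin k → ℚ} → f ≗ g → Σℚ f ≡ Σℚ g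
Σℚ-cong {zero} f≗g = refl
Σℚ-cong {suc k} f≗g = cong₂ _+_ (f≗g zero) (Σℚ-cong (f≗g ∘ suc))

Σℚ-zero : ∀ k → Σℚ {k} (λ _ → 0ℚ) ≡ 0ℚ
Σℚ-zero k = trans (Σℚ≡sum {k} (λ _ → 0ℚ)) (ℚΣ.sum-replicate-zero k)

Σℚ-distrib-+ : ∀ {k} (f g : Fin k → ℚ) → Σℚ (λ i → f i + g i) ≡ Σℚ f + Σℚ g
Σℚ-distrib-+ f g = trans (Σℚ≡sum (λ i → f i + g i))
  (trans (ℚΣ.∑-distrib-+ f g) (sym (cong₂ _+_ (Σℚ≡sum f) (Σℚ≡sum g))))

Σℚ-neg : ∀ {k} (f : Fin k → ℚ) → Σℚ (λ i → - f i) ≡ - Σℚ f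
Σℚ-neg {zero} f = refl
Σℚ-neg {suc k} f =
  trans (cong (- f zero +_) (Σℚ-neg (f ∘ suc))) (sym (ℚP.neg-distrib-+ (f zero) (Σℚ (f ∘ suc))))

Σℚ-distrib-- : ∀ {k} (f g : Fin k → ℚ) → Σℚ (λ i → f i - g i) ≡ Σℚ f - Σℚ g
Σℚ-distrib-- f g = trans (Σℚ-distrib-+ f (-_ ∘ g)) (cong (Σℚ f +_) (Σℚ-neg g))

*-distribˡ-Σℚ : ∀ {k} a (f : Fin k → ℚ) → a * Σℚ f ≡ Σℚ (λ i → a * f i)
*-distribˡ-Σℚ a f = trans (cong (a *_) (Σℚ≡sum f))
  (trans (ℚΣ.*-distribˡ-sum a f) (sym (Σℚ≡sum (λ i → a * f i))))

*-distribʳ-Σℚ : ∀ {k} a (f : Fin k → ℚ) → Σℚ f * a ≡ Σℚ (λ i → f i * a)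
*-distribʳ-Σℚ a f = trans (cong (_* a) (Σℚ≡sum f))
  (trans (ℚΣ.*-distribʳ-sum a f) (sym (Σℚ≡sum (λ i → f i * a))))

Σℚ-comm : ∀ {k l} (f : Fin k → Fin l → ℚ) →
  Σℚ (λ i → Σℚ (f i)) ≡ Σℚ (λ j → Σℚ (λ i → f i j))
Σℚ-comm f = trans (Σℚ≡sum₂ f) (trans (ℚΣ.∑-comm f) (sym (Σℚ≡sum₂ (λ j i → f i j))))
  where
  Σℚ≡sum₂ : ∀ {k l} (g : Fin k → Fin l → ℚ) → Σℚ (λ i → Σℚ (g i)) ≡ ℚΣ.sum (λ i → ℚΣ.sum (g i))
  Σℚ≡sum₂ g = trans (Σℚ-cong (λ i → Σℚ≡sum (g i))) (Σℚ≡sum (λ i → ℚΣ.sum (g i)))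

Σℚ-removeAt : ∀ {k} (f : Fin (suc k) → ℚ) i → Σℚ f ≡ f i + Σℚ (removeAt f i)
Σℚ-removeAt f i = trans (Σℚ≡sum f)
  (trans (ℚΣ.sum-remove f) (cong (f i +_) (sym (Σℚ≡sum (removeAt f i)))))

Σℚ-insertAt : ∀ {k} (c : Fin k → ℚ) j x → Σℚ (insertAt c j x) ≡ x + Σℚ c
Σℚ-insertAt c j x = trans (Σℚ-removeAt (insertAt c j x) j)
  (cong₂ _+_ (insertAt-lookup c j x) (Σℚ-cong (insertAt-punchIn c j x)))

Σℚ-mono-≤ : ∀ {k} {f g : Fin k → ℚ} → (∀ i → f i ℚ.≤ g i) → Σℚ f ℚ.≤ Σℚ g
Σℚ-mono-≤ {zero} f≤g = ℚP.≤-refl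
Σℚ-mono-≤ {suc k} f≤g = ℚP.+-mono-≤ (f≤g zero) (Σℚ-mono-≤ (f≤g ∘ suc))

Σℚ-mono-< : ∀ {k} {f g : Fin (suc k) → ℚ} → (∀ i → f i ℚ.< g i) → Σℚ f ℚ.< Σℚ g
Σℚ-mono-< f<g = ℚP.+-mono-<-≤ (f<g zero) (Σℚ-mono-≤ (ℚP.<⇒≤ ∘ f<g ∘ suc))

Σℚ-nonNeg : ∀ {k} {f : Fin k → ℚ} → (∀ i → 0ℚ ℚ.≤ f i) → 0ℚ ℚ.≤ Σℚ f
Σℚ-nonNeg {k} {f} f≥0 = subst (ℚ._≤ Σℚ f) (Σℚ-zero k) (Σℚ-mono-≤ f≥0)

-- Linear combinations

0ᵖ : ∀ {N} → Pt N
0ᵖ _ = 0ℚ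

infixl 25 _⊖_

_⊖_ : ∀ {N} → Pt N → Pt N → Pt N
(x ⊖ y) j = x j - y j

lincomb-cong : ∀ {N k} {c d : Fin k → ℚ} (p : Fin k → Pt N) → c ≗ d → lincomb c p ≈ lincomb d p
lincomb-cong p c≗d t = Σℚ-cong (λ i → cong (_* p i t) (c≗d i))

lincomb-zeroˡ : ∀ {N k} (p : Fin k → Pt N) → lincomb (λ _ → 0ℚ) p ≈ 0ᵖ
lincomb-zeroˡ {k = k} p t = trans (Σℚ-cong (λ i → ℚP.*-zeroˡ (p i t))) (Σℚ-zero k)

lincomb-removeAt : ∀ {N k} (c : Fin (suc k) → ℚ) (p : Fin (suc k) → Pt N) j t →
  lincomb c p t ≡ c j * p j t + lincomb (removeAt c j) (removeAt p j) t
lincomb-removeAt c p j t = Σℚ-removeAt (λ i → c i * p i t) j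

lincomb-insertAt : ∀ {N k} (c : Fin k → ℚ) x (p : Fin (suc k) → Pt N) j t →
  lincomb (insertAt c j x) p t ≡ x * p j t + lincomb c (removeAt p j) t
lincomb-insertAt c x p j t = trans (lincomb-removeAt (insertAt c j x) p j t)
  (cong₂ _+_ (cong (_* p j t) (insertAt-lookup c j x))
             (lincomb-cong (removeAt p j) (insertAt-punchIn c j x) t))

lincomb-scale : ∀ {N k} a (c : Fin k → ℚ) (p : Fin k → Pt N) →
  lincomb (λ i → a * c i) p ≈ (a • lincomb c p)
lincomb-scale a c p t = trans (Σℚ-cong (λ i → ℚP.*-assoc a (c i) (p i t)))
  (sym (*-distribˡ-Σℚ a (λ i → c i * p i t)))

lincomb-distrib-- : ∀ {N k} (c d : Fin k → ℚ) (p : Fin k → Pt N) →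
  lincomb (λ i → c i - d i) p ≈ lincomb c p ⊖ lincomb d p
lincomb-distrib-- c d p t =
  trans (Σℚ-cong (λ i → solve 3 (λ x y z → (x :- y) :* z := x :* z :- y :* z) refl (c i) (d i) (p i t)))
        (Σℚ-distrib-- (λ i → c i * p i t) (λ i → d i * p i t))

lincomb-const : ∀ {N k} (c : Fin k → ℚ) (x : Pt N) → lincomb c (λ _ → x) ≈ (Σℚ c • x)
lincomb-const c x t = sym (*-distribʳ-Σℚ (x t) c)

lincomb-⊖ : ∀ {N k} (c : Fin k → ℚ) (p q : Fin k → Pt N) →
  lincomb c (λ i → p i ⊖ q i) ≈ lincomb c p ⊖ lincomb c q
lincomb-⊖ c p q t =
  trans (Σℚ-cong (λ i → ℚP.*-distribˡ-+ (c i) (p i t) (- q i t)))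
  (trans (Σℚ-distrib-+ (λ i → c i * p i t) (λ i → c i * - q i t))
         (cong (lincomb c p t +_) (trans (Σℚ-cong (λ i → sym (ℚP.neg-distribʳ-* (c i) (q i t))))
                                         (Σℚ-neg (λ i → c i * q i t)))))

lincomb-lincomb : ∀ {N k m} (μ : Fin k → ℚ) (c : Fin k → Fin m → ℚ) (v : Fin m → Pt N) →
  lincomb μ (λ i → lincomb (c i) v) ≈ lincomb (λ j → Σℚ (λ i → μ i * c i j)) v
lincomb-lincomb μ c v t = begin
  Σℚ (λ i → μ i * Σℚ (λ j → c i j * v j t))
    ≡⟨ Σℚ-cong (λ i → *-distribˡ-Σℚ (μ i) (λ j → c i j * v j t)) ⟩
  Σℚ (λ i → Σℚ (λ j → μ i * (c i j * v j t)))
    ≡⟨ Σℚ-comm (λ i j → μ i * (c i j * v j t)) ⟩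
  Σℚ (λ j → Σℚ (λ i → μ i * (c i j * v j t)))
    ≡⟨ Σℚ-cong (λ j → Σℚ-cong (λ i → sym (ℚP.*-assoc (μ i) (c i j) (v j t)))) ⟩
  Σℚ (λ j → Σℚ (λ i → μ i * c i j * v j t))
    ≡⟨ Σℚ-cong (λ j → sym (*-distribʳ-Σℚ (v j t) (λ i → μ i * c i j))) ⟩
  Σℚ (λ j → Σℚ (λ i → μ i * c i j) * v j t) ∎
  where open ≡-Reasoning

-- Convex hulls

ConvHull-resp-≈ : ∀ {N m} {v : Fin m → Pt N} {x y} → x ≈ y → ConvHull v x → ConvHull v y
ConvHull-resp-≈ x≈y (c , c≥0 , Σc≡1 , x≈cv) = c , c≥0 , Σc≡1 , λ t → trans (sym (x≈y t)) (x≈cv t)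

ConvHull-empty : ∀ {N} {v : Fin 0 → Pt N} {x} → ¬ ConvHull v x
ConvHull-empty (_ , _ , Σc≡1 , _) = ℚP.1≢0 (sym Σc≡1)

ConvHull-vertex : ∀ {N m} (v : Fin m → Pt N) j → ConvHull v (v j)
ConvHull-vertex {m = suc m} v j = e , e≥0 , Σe≡1 , vj≈ev
  where
  e : Fin (suc m) → ℚ
  e = insertAt (λ _ → 0ℚ) j 1ℚ
  e≥0 : ∀ i → 0ℚ ℚ.≤ e i
  e≥0 = punchIn-cover j (subst (0ℚ ℚ.≤_) (sym (insertAt-lookup _ j 1ℚ)) (ℚP.nonNegative⁻¹ 1ℚ))
                        (λ i → ℚP.≤-reflexive (sym (insertAt-punchIn _ j 1ℚ i)))
  Σe≡1 : Σℚ e ≡ 1ℚ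
  Σe≡1 = trans (Σℚ-insertAt _ j 1ℚ) (trans (cong (1ℚ +_) (Σℚ-zero m)) (ℚP.+-identityʳ 1ℚ))
  vj≈ev : v j ≈ lincomb e v
  vj≈ev t = sym (begin
    lincomb e v t
      ≡⟨ lincomb-insertAt _ 1ℚ v j t ⟩
    1ℚ * v j t + lincomb (λ _ → 0ℚ) (removeAt v j) t
      ≡⟨ cong₂ _+_ (ℚP.*-identityˡ (v j t)) (lincomb-zeroˡ (removeAt v j) t) ⟩
    v j t + 0ℚ
      ≡⟨ ℚP.+-identityʳ (v j t) ⟩
    v j t ∎)
    where open ≡-Reasoning

ConvHull-convex : ∀ {N m k} (v : Fin m → Pt N) (p : Fin k → Pt N) (μ : Fin k → ℚ) →
  (∀ i → 0ℚ ℚ.≤ μ i) → Σℚ μ ≡ 1ℚ → (∀ i → ConvHull v (p i)) → ConvHull v (lincomb μ p)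
ConvHull-convex v p μ μ≥0 Σμ≡1 p∈hull = c , c≥0 , Σc≡1 , μp≈cv
  where
  d : _ → _ → ℚ
  d i = proj₁ (p∈hull i)
  c : _ → ℚ
  c j = Σℚ (λ i → μ i * d i j)
  c≥0 : ∀ j → 0ℚ ℚ.≤ c j
  c≥0 j = Σℚ-nonNeg (λ i → *-nonNeg (μ≥0 i) (proj₁ (proj₂ (p∈hull i)) j))
  Σc≡1 : Σℚ c ≡ 1ℚ
  Σc≡1 = begin
    Σℚ c
      ≡⟨ Σℚ-comm (λ i j → μ i * d i j) ⟨
    Σℚ (λ i → Σℚ (λ j → μ i * d i j))
      ≡⟨ Σℚ-cong (λ i → *-distribˡ-Σℚ (μ i) (d i)) ⟨
    Σℚ (λ i → μ i * Σℚ (d i))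
      ≡⟨ Σℚ-cong (λ i → cong (μ i *_) (proj₁ (proj₂ (proj₂ (p∈hull i))))) ⟩
    Σℚ (λ i → μ i * 1ℚ)
      ≡⟨ Σℚ-cong (λ i → ℚP.*-identityʳ (μ i)) ⟩
    Σℚ μ
      ≡⟨ Σμ≡1 ⟩
    1ℚ ∎
    where open ≡-Reasoning
  μp≈cv : lincomb μ p ≈ lincomb c v
  μp≈cv t = trans (Σℚ-cong (λ i → cong (μ i *_) (proj₂ (proj₂ (proj₂ (p∈hull i))) t)))
                  (lincomb-lincomb μ d v t)

ConvHull-∘ : ∀ {N m k} (v : Fin m → Pt N) (σ : Fin k → Fin m) {y} → ConvHull (v ∘ σ) y → ConvHull v y
ConvHull-∘ v σ (c , c≥0 , Σc≡1 , y≈cvσ) =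
  ConvHull-resp-≈ (sym ∘ y≈cvσ) (ConvHull-convex v (v ∘ σ) c c≥0 Σc≡1 (ConvHull-vertex v ∘ σ))

ConvHull-midpoint : ∀ {N m} {v : Fin m → Pt N} {y₁ y₂} → ConvHull v y₁ → ConvHull v y₂ →
  ConvHull v (lincomb (λ _ → ½) (y₁ ∷ y₂ ∷ []))
ConvHull-midpoint {v = v} {y₁} {y₂} y₁∈ y₂∈ = ConvHull-convex v (y₁ ∷ y₂ ∷ []) (λ _ → ½) (λ _ → ½≥0) refl
  λ { zero → y₁∈ ; (suc zero) → y₂∈ }
  where
  ½≥0 : 0ℚ ℚ.≤ ½
  ½≥0 = ℚP.nonNegative⁻¹ ½

ConvHull-removeAt : ∀ {N k} (p : Fin (suc k) → Pt N) {y} (h : ConvHull p y) j →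
  proj₁ h j ≡ 0ℚ → ConvHull (removeAt p j) y
ConvHull-removeAt p {y} (c , c≥0 , Σc≡1 , y≈cp) j cj≡0 = removeAt c j , c≥0 ∘ punchIn j , Σc′≡1 , y≈c′p′
  where
  Σc′≡1 : Σℚ (removeAt c j) ≡ 1ℚ
  Σc′≡1 = begin
    Σℚ (removeAt c j)            ≡⟨ ℚP.+-identityˡ (Σℚ (removeAt c j)) ⟨
    0ℚ + Σℚ (removeAt c j)       ≡⟨ cong (_+ Σℚ (removeAt c j)) cj≡0 ⟨
    c j + Σℚ (removeAt c j)      ≡⟨ Σℚ-removeAt c j ⟨
    Σℚ c                         ≡⟨ Σc≡1 ⟩
    1ℚ                           ∎
    where open ≡-Reasoning
  y≈c′p′ : y ≈ lincomb (removeAt c j) (removeAt p j)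
  y≈c′p′ t = let r = lincomb (removeAt c j) (removeAt p j) t in begin
    y t
      ≡⟨ y≈cp t ⟩
    lincomb c p t
      ≡⟨ lincomb-removeAt c p j t ⟩
    c j * p j t + lincomb (removeAt c j) (removeAt p j) t
      ≡⟨ cong (λ z → z * p j t + r) cj≡0 ⟩
    0ℚ * p j t + lincomb (removeAt c j) (removeAt p j) t
      ≡⟨ solve 2 (λ a b → con 0ℚ :* a :+ b := b) refl (p j t) r ⟩
    lincomb (removeAt c j) (removeAt p j) t ∎
    where open ≡-Reasoning

-- Linear and affine dependence

LinDep : ∀ {N k} → (Fin k → Pt N) → Set
LinDep {k = k} u = Σ (Fin k → ℚ) λ c → lincomb c u ≈ 0ᵖ × Σ (Fin k) λ i → c i ≢ 0ℚ

LinIndep : ∀ {N k} → (Fin k → Pt N) → Set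
LinIndep u = ∀ c → lincomb c u ≈ 0ᵖ → ∀ i → c i ≡ 0ℚ

-- Clearing the pivot column by cross-multiplying with the pivot a rather than dividing by it.
module Pivot {N k} (u : Fin (suc k) → Pt (suc N)) (j : Fin (suc k)) (a≢0 : u j zero ≢ 0ℚ) where

  a : ℚ
  a = u j zero

  h : Fin k → ℚ
  h i = u (punchIn j i) zero

  eliminated : Fin k → Pt N
  eliminated i = (a • tail (u (punchIn j i))) ⊖ (h i • tail (u j))

  lincomb-eliminated : ∀ c t → lincomb c eliminated t ≡
    a * lincomb c (removeAt u j) (suc t) - lincomb c (removeAt u j) zero * u j (suc t)
  lincomb-eliminated c t = let U = u j (suc t) in begin
    Σℚ (λ i → c i * (a * u (punchIn j i) (suc t) - h i * U))
      ≡⟨ Σℚ-cong (λ i → solve 5 (λ c a x h U → c :* (a :* x :- h :* U) := a :* (c :* x) :- c :* h :* U)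
                                  refl (c i) a (u (punchIn j i) (suc t)) (h i) U) ⟩
    Σℚ (λ i → a * (c i * u (punchIn j i) (suc t)) - c i * h i * U)
      ≡⟨ Σℚ-distrib-- (λ i → a * (c i * u (punchIn j i) (suc t))) (λ i → c i * h i * U) ⟩
    Σℚ (λ i → a * (c i * u (punchIn j i) (suc t))) - Σℚ (λ i → c i * h i * U)
      ≡⟨ cong₂ _-_ (*-distribˡ-Σℚ a (λ i → c i * u (punchIn j i) (suc t)))
                   (*-distribʳ-Σℚ U (λ i → c i * h i)) ⟨
    a * lincomb c (removeAt u j) (suc t) - lincomb c (removeAt u j) zero * U ∎
    where open ≡-Reasoning

  liftDep : LinDep eliminated → LinDep u
  liftDep (c , ce≈0 , i₀ , ci₀≢0) = d , du≈0 , punchIn j i₀ , di₀≢0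
    where
    S : ℚ
    S = lincomb c (removeAt u j) zero
    d : Fin (suc k) → ℚ
    d = insertAt (λ i → a * c i) j (- S)
    du≈ : ∀ t → lincomb d u t ≡ - S * u j t + a * lincomb c (removeAt u j) t
    du≈ t = trans (lincomb-insertAt (λ i → a * c i) (- S) u j t)
                  (cong (- S * u j t +_) (lincomb-scale a c (removeAt u j) t))
    du≈0 : lincomb d u ≈ 0ᵖ
    du≈0 zero = trans (du≈ zero) (solve 2 (λ S a → :- S :* a :+ a :* S := con 0ℚ) refl S a)
    du≈0 (suc t) = begin
      lincomb d u (suc t)
        ≡⟨ du≈ (suc t) ⟩
      - S * U + a * X
        ≡⟨ solve 4 (λ S U a X → :- S :* U :+ a :* X := a :* X :- S :* U) refl S U a X ⟩
      a * X - S * U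
        ≡⟨ lincomb-eliminated c t ⟨
      lincomb c eliminated t
        ≡⟨ ce≈0 t ⟩
      0ℚ ∎
      where
      open ≡-Reasoning
      U = u j (suc t)
      X = lincomb c (removeAt u j) (suc t)
    di₀≢0 : d (punchIn j i₀) ≢ 0ℚ
    di₀≢0 = x#0y#0→xy#0 a≢0 ci₀≢0 ∘ trans (sym (insertAt-punchIn (λ i → a * c i) j (- S) i₀))

  liftIndep : LinIndep eliminated → LinIndep u
  liftIndep indep c cu≈0 = punchIn-cover j cj≡0 c′≡0
    where
    c′ : Fin k → ℚ
    c′ = removeAt c j
    split : ∀ t → c j * u j t + lincomb c′ (removeAt u j) t ≡ 0ℚ
    split t = trans (sym (lincomb-removeAt c u j t)) (cu≈0 t)
    c′e≈0 : lincomb c′ eliminated ≈ 0ᵖ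
    c′e≈0 t = begin
      lincomb c′ eliminated t
        ≡⟨ lincomb-eliminated c′ t ⟩
      a * X - S * U
        ≡⟨ solve 5 (λ a X S U cj → a :* X :- S :* U := a :* (cj :* U :+ X) :- U :* (cj :* a :+ S))
                   refl a X S U (c j) ⟩
      a * (c j * U + X) - U * (c j * a + S)
        ≡⟨ cong₂ (λ x y → a * x - U * y) (split (suc t)) (split zero) ⟩
      a * 0ℚ - U * 0ℚ
        ≡⟨ solve 2 (λ a U → a :* con 0ℚ :- U :* con 0ℚ := con 0ℚ) refl a U ⟩
      0ℚ ∎
      where
      open ≡-Reasoning
      S = lincomb c′ (removeAt u j) zero
      U = u j (suc t)
      X = lincomb c′ (removeAt u j) (suc t)
    c′≡0 : ∀ i → c′ i ≡ 0ℚ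
    c′≡0 = indep c′ c′e≈0
    S≡0 : lincomb c′ (removeAt u j) zero ≡ 0ℚ
    S≡0 = trans (lincomb-cong (removeAt u j) c′≡0 zero) (lincomb-zeroˡ (removeAt u j) zero)
    cj≡0 : c j ≡ 0ℚ
    cj≡0 = x*y≡0⇒x≡0 a≢0
      (trans (sym (ℚP.+-identityʳ (c j * a))) (trans (cong (c j * a +_) (sym S≡0)) (split zero)))

-- DimLE only excludes independent families, so Carathéodory's reduction needs an explicit
-- dependence whenever there is no independence: Gaussian elimination, one coordinate at a time.
linDep? : ∀ {N k} (u : Fin k → Pt N) → LinDep u ⊎ LinIndep u
linDep? {zero} {zero} u = inj₂ (λ _ _ ())
linDep? {zero} {suc k} u = inj₁ ((λ _ → 1ℚ) , (λ ()) , zero , ℚP.1≢0)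
linDep? {suc N} {zero} u = inj₂ (λ _ _ ())
linDep? {suc N} {suc k} u with FinP.all? (λ i → u i zero ℚP.≟ 0ℚ)
... | yes col₀≡0 = Sum.map extendDep extendIndep (linDep? (tail ∘ u))
  where
  extendDep : LinDep (tail ∘ u) → LinDep u
  extendDep (c , cu′≈0 , nz) = c , cu≈0 , nz
    where
    cu≈0 : lincomb c u ≈ 0ᵖ
    cu≈0 zero = trans (Σℚ-cong (λ i → trans (cong (c i *_) (col₀≡0 i)) (ℚP.*-zeroʳ (c i))))
                      (Σℚ-zero (suc k))
    cu≈0 (suc t) = cu′≈0 t
  extendIndep : LinIndep (tail ∘ u) → LinIndep u
  extendIndep indep c cu≈0 = indep c (cu≈0 ∘ suc)
... | no ¬col₀≡0 = Sum.map liftDep liftIndep (linDep? eliminated)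
  where
  pivot : Σ (Fin (suc k)) λ j → u j zero ≢ 0ℚ
  pivot = FinP.¬∀⟶∃¬ _ _ (λ i → u i zero ℚP.≟ 0ℚ) ¬col₀≡0
  open Pivot u (proj₁ pivot) (proj₂ pivot)

AffDep : ∀ {N k} → (Fin k → Pt N) → Set
AffDep {k = k} p = Σ (Fin k → ℚ) λ μ → Σℚ μ ≡ 0ℚ × lincomb μ p ≈ 0ᵖ × Σ (Fin k) λ i → μ i ≢ 0ℚ

module _ {N k} (p : Fin (suc k) → Pt N) where

  differences : Fin k → Pt N
  differences i = p (suc i) ⊖ p zero

  lincomb-differences : ∀ c → lincomb c differences ≈ lincomb ((- Σℚ c) ∷ c) p
  lincomb-differences c t = begin
    lincomb c differences t
      ≡⟨ lincomb-⊖ c (tail p) (λ _ → p zero) t ⟩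
    lincomb c (tail p) t - lincomb c (λ _ → p zero) t
      ≡⟨ cong (λ x → lincomb c (tail p) t - x) (lincomb-const c (p zero) t) ⟩
    lincomb c (tail p) t - Σℚ c * p zero t
      ≡⟨ solve 3 (λ X s y → X :- s :* y := :- s :* y :+ X)
                 refl (lincomb c (tail p) t) (Σℚ c) (p zero t) ⟩
    - Σℚ c * p zero t + lincomb c (tail p) t ∎
    where open ≡-Reasoning

  affDep? : AffDep p ⊎ AffIndep p
  affDep? = Sum.map fromLinDep fromLinIndep (linDep? differences)
    where
    fromLinDep : LinDep differences → AffDep p
    fromLinDep (c , cd≈0 , i₀ , ci₀≢0) =
      (- Σℚ c) ∷ c , ℚP.+-inverseˡ (Σℚ c) , (λ t → trans (sym (lincomb-differences c t)) (cd≈0 t)) ,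
      suc i₀ , ci₀≢0
    fromLinIndep : LinIndep differences → AffIndep p
    fromLinIndep indep μ Σμ≡0 μp≈0 = punchIn-cover zero μ₀≡0 μ′≡0
      where
      μ₀≡-Σμ′ : μ zero ≡ - Σℚ (tail μ)
      μ₀≡-Σμ′ = inverseˡ-unique (μ zero) (Σℚ (tail μ)) Σμ≡0
      μ′≡0 : ∀ i → tail μ i ≡ 0ℚ
      μ′≡0 = indep (tail μ) λ t → begin
        lincomb (tail μ) differences t
          ≡⟨ lincomb-differences (tail μ) t ⟩
        - Σℚ (tail μ) * p zero t + lincomb (tail μ) (tail p) t
          ≡⟨ cong (λ x → x * p zero t + lincomb (tail μ) (tail p) t) μ₀≡-Σμ′ ⟨
        lincomb μ p t
          ≡⟨ μp≈0 t ⟩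
        0ℚ ∎
        where open ≡-Reasoning
      μ₀≡0 : μ zero ≡ 0ℚ
      μ₀≡0 = trans μ₀≡-Σμ′ (cong -_ (trans (Σℚ-cong μ′≡0) (Σℚ-zero k)))

AffDep-positive : ∀ {N k} {p : Fin k → Pt N} → AffDep p →
  Σ (Fin k → ℚ) λ μ → Σℚ μ ≡ 0ℚ × lincomb μ p ≈ 0ᵖ × Σ (Fin k) λ i → 0ℚ ℚ.< μ i
AffDep-positive {p = p} (μ , Σμ≡0 , μp≈0 , i₀ , μi₀≢0) with ℚP.<-cmp 0ℚ (μ i₀)
... | tri< μi₀>0 _ _ = μ , Σμ≡0 , μp≈0 , i₀ , μi₀>0
... | tri≈ _ 0≡μi₀ _ = ⊥-elim (μi₀≢0 (sym 0≡μi₀))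
... | tri> _ _ μi₀<0 = -_ ∘ μ , Σ-μ≡0 , -μp≈0 , i₀ , ℚP.neg-antimono-< μi₀<0
  where
  Σ-μ≡0 : Σℚ (-_ ∘ μ) ≡ 0ℚ
  Σ-μ≡0 = trans (Σℚ-neg μ) (cong -_ Σμ≡0)
  -μp≈0 : lincomb (-_ ∘ μ) p ≈ 0ᵖ
  -μp≈0 t = trans (Σℚ-cong (λ i → sym (ℚP.neg-distribˡ-* (μ i) (p i t))))
                  (trans (Σℚ-neg (λ i → μ i * p i t)) (cong -_ (μp≈0 t)))

-- Carathéodory's theorem

-- f receives the proof of P i irrelevantly, so f i does not depend on which proof is given.
argmin : ∀ {k} {P : Fin k → Set} → Decidable P → (f : ∀ i → .(P i) → ℚ) → Σ (Fin k) P →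
  Σ (Fin k) λ r → Σ (P r) λ Pr → ∀ i (Pi : P i) → f r Pr ℚ.≤ f i Pi
argmin {suc k} {P} P? f (i₀ , Pi₀) with P? zero | FinP.any? (P? ∘ suc)
... | yes P0 | no ¬P′ = zero , P0 , λ { zero _ → ℚP.≤-refl ; (suc i) Pi → ⊥-elim (¬P′ (i , Pi)) }
... | no ¬P0 | no ¬P′ = ⊥-elim (punchIn-cover {P = ¬_ ∘ P} zero ¬P0 (λ i Pi → ¬P′ (i , Pi)) i₀ Pi₀)
... | no ¬P0 | yes P′ with argmin (P? ∘ suc) (f ∘ suc) P′
...   | r , Pr , min = suc r , Pr , λ { zero P0 → ⊥-elim (¬P0 P0) ; (suc i) Pi → min i Pi }
argmin {suc k} {P} P? f (i₀ , Pi₀) | yes P0 | yes P′ with argmin (P? ∘ suc) (f ∘ suc) P′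
... | r , Pr , min with f zero P0 ℚP.≤? f (suc r) Pr
...   | yes f0≤fr = zero , P0 , λ { zero _ → ℚP.≤-refl ; (suc i) Pi → ℚP.≤-trans f0≤fr (min i Pi) }
...   | no f0≰fr = suc r , Pr , λ { zero _ → ℚP.<⇒≤ (ℚP.≰⇒> f0≰fr) ; (suc i) Pi → min i Pi }

lincomb-shift : ∀ {N k} (p : Fin k → Pt N) (l μ : Fin k → ℚ) t → lincomb μ p ≈ 0ᵖ →
  lincomb (λ i → l i - t * μ i) p ≈ lincomb l p
lincomb-shift p l μ t μp≈0 x = begin
  lincomb (λ i → l i - t * μ i) p x
    ≡⟨ lincomb-distrib-- l (λ i → t * μ i) p x ⟩
  lincomb l p x - lincomb (λ i → t * μ i) p x
    ≡⟨ cong (λ z → lincomb l p x - z) (lincomb-scale t μ p x) ⟩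
  lincomb l p x - t * lincomb μ p x
    ≡⟨ cong (λ z → lincomb l p x - t * z) (μp≈0 x) ⟩
  lincomb l p x - t * 0ℚ
    ≡⟨ solve 2 (λ a t → a :- t :* con 0ℚ := a) refl (lincomb l p x) t ⟩
  lincomb l p x ∎
  where open ≡-Reasoning

Σℚ-shift : ∀ {k} (l μ : Fin k → ℚ) t → Σℚ μ ≡ 0ℚ → Σℚ (λ i → l i - t * μ i) ≡ Σℚ l
Σℚ-shift l μ t Σμ≡0 = begin
  Σℚ (λ i → l i - t * μ i)        ≡⟨ Σℚ-distrib-- l (λ i → t * μ i) ⟩
  Σℚ l - Σℚ (λ i → t * μ i)       ≡⟨ cong (λ z → Σℚ l - z) (*-distribˡ-Σℚ t μ) ⟨
  Σℚ l - t * Σℚ μ                 ≡⟨ cong (λ z → Σℚ l - t * z) Σμ≡0 ⟩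
  Σℚ l - t * 0ℚ                   ≡⟨ solve 2 (λ a t → a :- t :* con 0ℚ := a) refl (Σℚ l) t ⟩
  Σℚ l                            ∎
  where open ≡-Reasoning

-- Shift the coefficients l along the dependence μ by t = min {lᵢ/μᵢ : μᵢ > 0}:
-- they stay nonnegative and the r-th one, where the minimum is attained, vanishes.
ConvHull-removeVertex : ∀ {N k} (p : Fin (suc k) → Pt N) → AffDep p →
  ∀ {y} → ConvHull p y → Σ (Fin (suc k)) λ r → ConvHull (removeAt p r) y
ConvHull-removeVertex {k = k} p dep {y} (l , l≥0 , Σl≡1 , y≈lp) with AffDep-positive {p = p} dep
... | μ , Σμ≡0 , μp≈0 , ∃μ>0 = r , ConvHull-removeAt p (l′ , l′≥0 , Σl′≡1 , y≈l′p) r l′r≡0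
  where
  least = argmin (λ i → 0ℚ ℚP.<? μ i) (λ i → ratio (l i) (μ i)) ∃μ>0
  r = proj₁ least
  μr>0 = proj₁ (proj₂ least)
  t = ratio (l r) (μ r) μr>0
  l′ : Fin (suc k) → ℚ
  l′ i = l i - t * μ i
  t≥0 : 0ℚ ℚ.≤ t
  t≥0 = ratio-nonNeg (l≥0 r) μr>0
  tμ≤l : ∀ i → t * μ i ℚ.≤ l i
  tμ≤l i with 0ℚ ℚP.<? μ i
  ... | yes μi>0 = begin
    t * μ i                          ≤⟨ ℚP.*-monoʳ-≤-nonNeg (μ i) {{ℚ.nonNegative (ℚP.<⇒≤ μi>0)}}
                                          (proj₂ (proj₂ least) i μi>0) ⟩
    ratio (l i) (μ i) μi>0 * μ i     ≡⟨ ratio-* (l i) (μ i) μi>0 ⟩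
    l i                              ∎
    where open ℚP.≤-Reasoning
  ... | no μi≯0 = begin
    t * μ i                          ≤⟨ ℚP.*-monoˡ-≤-nonNeg t {{ℚ.nonNegative t≥0}} (ℚP.≮⇒≥ μi≯0) ⟩
    t * 0ℚ                           ≡⟨ ℚP.*-zeroʳ t ⟩
    0ℚ                               ≤⟨ l≥0 i ⟩
    l i                              ∎
    where open ℚP.≤-Reasoning
  l′≥0 : ∀ i → 0ℚ ℚ.≤ l′ i
  l′≥0 = p≤q⇒0≤q-p ∘ tμ≤l
  Σl′≡1 : Σℚ l′ ≡ 1ℚ
  Σl′≡1 = trans (Σℚ-shift l μ t Σμ≡0) Σl≡1
  y≈l′p : y ≈ lincomb l′ p
  y≈l′p x = trans (y≈lp x) (sym (lincomb-shift p l μ t μp≈0 x))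
  l′r≡0 : l′ r ≡ 0ℚ
  l′r≡0 = trans (cong (λ z → l r - z) (ratio-* (l r) (μ r) μr>0)) (ℚP.+-inverseʳ (l r))

caratheodory : ∀ {N m} (v : Fin m → Pt N) n → DimLE (ConvHull v) n → ∀ {y} → ConvHull v y →
  Σ ℕ λ k → k ≤ n × Σ (Fin (suc k) → Fin m) λ σ → ConvHull (v ∘ σ) y
caratheodory {m = zero} v n dim y∈P = ⊥-elim (ConvHull-empty {v = v} y∈P)
caratheodory {m = suc m} v n dim {y} y∈P = shrink m id y∈P
  where
  Reduced : Set
  Reduced = Σ ℕ λ k → k ≤ n × Σ (Fin (suc k) → Fin (suc m)) λ σ → ConvHull (v ∘ σ) y
  shrink : ∀ k (σ : Fin (suc k) → Fin (suc m)) → ConvHull (v ∘ σ) y → Reduced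
  shrink zero σ y∈ = zero , ℕ.z≤n , σ , y∈
  shrink (suc k) σ y∈ with suc k ℕP.≤? n
  ... | yes k<n = suc k , k<n , σ , y∈
  ... | no k≮n = Sum.[ drop , ⊥-elim ∘ k≮n ∘ dim (suc k) (v ∘ σ) (ConvHull-vertex v ∘ σ) ]
                   (affDep? (v ∘ σ))
    where
    drop : AffDep (v ∘ σ) → Reduced
    drop dep = let r , y∈′ = ConvHull-removeVertex (v ∘ σ) dep y∈ in shrink k (removeAt σ r) y∈′

-- Rounding down to a lattice point

module ℕΣ = SemiringSum ℕP.+-*-semiring

sum-suc : ∀ {k} (f : Fin k → ℕ) → ℕΣ.sum (suc ∘ f) ≡ k ℕ.+ ℕΣ.sum f
sum-suc {zero} f = refl
sum-suc {suc k} f = cong suc (begin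
  f zero ℕ.+ ℕΣ.sum (suc ∘ f ∘ suc)        ≡⟨ cong (f zero ℕ.+_) (sum-suc (f ∘ suc)) ⟩
  f zero ℕ.+ (k ℕ.+ ℕΣ.sum (f ∘ suc))      ≡⟨ ℕP.+-assoc (f zero) k _ ⟨
  f zero ℕ.+ k ℕ.+ ℕΣ.sum (f ∘ suc)        ≡⟨ cong (ℕ._+ ℕΣ.sum (f ∘ suc)) (ℕP.+-comm (f zero) k) ⟩
  k ℕ.+ f zero ℕ.+ ℕΣ.sum (f ∘ suc)        ≡⟨ ℕP.+-assoc k (f zero) _ ⟩
  k ℕ.+ ℕΣ.sum f                           ∎)
  where open ≡-Reasoning

nat-sum : ∀ {k} (f : Fin k → ℕ) → nat (ℕΣ.sum f) ≡ Σℚ (nat ∘ f)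
nat-sum {zero} f = refl
nat-sum {suc k} f =
  trans (nat-homo-+ (f zero) (ℕΣ.sum (f ∘ suc))) (cong (nat (f zero) +_) (nat-sum (f ∘ suc)))

n≤sum⇒∃≤-sum≡n : ∀ {k} (f : Fin k → ℕ) n → n ≤ ℕΣ.sum f →
  Σ (Fin k → ℕ) λ a → (∀ i → a i ≤ f i) × ℕΣ.sum a ≡ n
n≤sum⇒∃≤-sum≡n {zero} f .zero ℕ.z≤n = (λ ()) , (λ ()) , refl
n≤sum⇒∃≤-sum≡n {suc k} f n n≤Σf with f zero ℕP.≤? n
... | no f₀≰n = (n ∷ λ _ → 0) , (λ { zero → ℕP.<⇒≤ (ℕP.≰⇒> f₀≰n) ; (suc i) → ℕ.z≤n }) ,
                trans (cong (n ℕ.+_) (ℕΣ.sum-replicate-zero k)) (ℕP.+-identityʳ n)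
... | yes f₀≤n with n≤sum⇒∃≤-sum≡n (f ∘ suc) (n ℕ.∸ f zero) (ℕP.m≤n+o⇒m∸n≤o n (f zero) n≤Σf)
...   | a , a≤f , Σa≡n-f₀ = (f zero ∷ a) , (λ { zero → ℕP.≤-refl ; (suc i) → a≤f i }) ,
                            trans (cong (f zero ℕ.+_) Σa≡n-f₀) (ℕP.m+[n∸m]≡n f₀≤n)

-- Each floor loses less than 1, so Σ ⌊αᵢ⌋ > Σ α − (k + 1) ≥ n − 1.
round-down : ∀ {k} n (α : Fin (suc k) → ℚ) → (∀ i → 0ℚ ℚ.≤ α i) → nat (k ℕ.+ n) ℚ.≤ Σℚ α →
  Σ (Fin (suc k) → ℕ) λ a → (∀ i → nat (a i) ℚ.≤ α i) × Σℚ (nat ∘ a) ≡ nat n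
round-down {k} n α α≥0 k+n≤Σα =
  a , (λ i → ℚP.≤-trans (nat-mono-≤ (a≤f i)) (f≤α i)) , trans (sym (nat-sum a)) (cong nat Σa≡n)
  where
  f : Fin (suc k) → ℕ
  f i = proj₁ (nat-floor (α i) (α≥0 i))
  f≤α : ∀ i → nat (f i) ℚ.≤ α i
  f≤α i = proj₁ (proj₂ (nat-floor (α i) (α≥0 i)))
  α<1+f : ∀ i → α i ℚ.< nat (suc (f i))
  α<1+f i = proj₂ (proj₂ (nat-floor (α i) (α≥0 i)))
  Σα<Σ[1+f] : Σℚ α ℚ.< nat (ℕΣ.sum (suc ∘ f))
  Σα<Σ[1+f] = subst (Σℚ α ℚ.<_) (sym (nat-sum (suc ∘ f))) (Σℚ-mono-< α<1+f)
  k+n<1+k+Σf : k ℕ.+ n ℕ.< suc (k ℕ.+ ℕΣ.sum f)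
  k+n<1+k+Σf = subst (k ℕ.+ n ℕ.<_) (sum-suc f) (nat-cancel-< (ℚP.≤-<-trans k+n≤Σα Σα<Σ[1+f]))
  n≤Σf : n ≤ ℕΣ.sum f
  n≤Σf = ℕP.+-cancelˡ-≤ k n (ℕΣ.sum f) (ℕ.s≤s⁻¹ k+n<1+k+Σf)
  a = proj₁ (n≤sum⇒∃≤-sum≡n f n n≤Σf)
  a≤f = proj₁ (proj₂ (n≤sum⇒∃≤-sum≡n f n n≤Σf))
  Σa≡n = proj₂ (proj₂ (n≤sum⇒∃≤-sum≡n f n n≤Σf))

lattice-lincomb : ∀ {N k} (a : Fin k → ℤ) (w : Fin k → LPt N) →
  Σ (LPt N) λ z → emb z ≈ lincomb (λ i → a i / 1) (emb ∘ w)
lattice-lincomb {k = zero} a w = (λ _ → ℤ.0ℤ) , λ _ → refl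
lattice-lincomb {k = suc k} a w with lattice-lincomb (a ∘ suc) (w ∘ suc)
... | z , z≈ = (λ t → a zero ℤ.* w zero t ℤ.+ z t) ,
  λ t → trans (/1-homo-+ (a zero ℤ.* w zero t) (z t)) (cong₂ _+_ (/1-homo-* (a zero) (w zero t)) (z≈ t))

-- Dilations

dilate-resp-≈ : ∀ {N} n {S : PSet N} {x x′} → x ≈ x′ → dilate n S x → dilate n S x′
dilate-resp-≈ n x≈x′ (y , y∈S , x≈ny) = y , y∈S , λ t → trans (sym (x≈x′ t)) (x≈ny t)

dilate-mono : ∀ {N} n {S T : PSet N} → (∀ {y} → S y → T y) → ∀ {x} → dilate n S x → dilate n T x
dilate-mono n S⊆T (y , y∈S , x≈ny) = y , S⊆T y∈S , x≈ny

lincomb∈dilate-ConvHull : ∀ {N k} n → 1 ≤ n → (p : Fin k → Pt N) (β : Fin k → ℚ) →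
  (∀ i → 0ℚ ℚ.≤ β i) → Σℚ β ≡ nat n → dilate n (ConvHull p) (lincomb β p)
lincomb∈dilate-ConvHull n 1≤n p β β≥0 Σβ≡n =
  lincomb c p , (c , c≥0 , Σc≡1 , λ _ → refl) ,
  λ t → trans (sym (lincomb-cong p n*c≡β t)) (lincomb-scale (nat n) c p t)
  where
  n>0 : 0ℚ ℚ.< nat n
  n>0 = ℚP.<-≤-trans (ℚP.positive⁻¹ 1ℚ) (nat-mono-≤ 1≤n)
  c : _ → ℚ
  c i = ratio (β i) (nat n) n>0
  c≥0 : ∀ i → 0ℚ ℚ.≤ c i
  c≥0 i = ratio-nonNeg (β≥0 i) n>0
  n*c≡β : ∀ i → nat n * c i ≡ β i
  n*c≡β i = trans (ℚP.*-comm (nat n) (c i)) (ratio-* (β i) (nat n) n>0)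
  Σc≡1 : Σℚ c ≡ 1ℚ
  Σc≡1 = begin
    Σℚ c              ≡⟨ *-distribʳ-Σℚ 1/n β ⟨
    Σℚ β * 1/n        ≡⟨ cong (_* 1/n) Σβ≡n ⟩
    nat n * 1/n       ≡⟨ ℚP.*-inverseʳ (nat n) {{n≢0}} ⟩
    1ℚ                ∎
    where
    open ≡-Reasoning
    n≢0 = ℚP.pos⇒nonZero (nat n) {{ℚ.positive n>0}}
    1/n = (ℚ.1/ nat n) {{n≢0}}

LatticeSplit : ∀ {N} → ℕ → PSet N → PSet N
LatticeSplit n S = Mink (latticePts (dilate n S)) (dilate n S)

LatticeSplit-mono : ∀ {N} n {S T : PSet N} → (∀ {y} → S y → T y) →
  ∀ {x} → LatticeSplit n S x → LatticeSplit n T x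
LatticeSplit-mono n S⊆T (a , b , (z , z∈nS , a≈z) , b∈nS , x≈a+b) =
  a , b , (z , dilate-mono n S⊆T z∈nS , a≈z) , dilate-mono n S⊆T b∈nS , x≈a+b

LatticeSplit-resp-≈ : ∀ {N} n {S : PSet N} {x x′} → x ≈ x′ → LatticeSplit n S x → LatticeSplit n S x′
LatticeSplit-resp-≈ n x≈x′ (a , b , a∈ , b∈ , x≈a+b) =
  a , b , a∈ , b∈ , λ t → trans (sym (x≈x′ t)) (x≈a+b t)

lincomb∈LatticeSplit : ∀ {N k} n → 1 ≤ n → (w : Fin k → LPt N) (β : Fin k → ℚ) (a : Fin k → ℕ) →
  (∀ i → nat (a i) ℚ.≤ β i) → Σℚ β ≡ nat (n ℕ.+ n) → Σℚ (nat ∘ a) ≡ nat n →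
  LatticeSplit n (LatticePolytope w) (lincomb β (emb ∘ w))
lincomb∈LatticeSplit n 1≤n w β a a≤β Σβ≡2n Σa≡n =
  emb z , lincomb β-a W , (z , z∈nΔ , λ _ → refl) , β-a∈nΔ , βW≈z+[β-a]W
  where
  W = emb ∘ w
  β-a : _ → ℚ
  β-a i = β i - nat (a i)
  z = proj₁ (lattice-lincomb (ℤ.+_ ∘ a) w)
  z≈aW : emb z ≈ lincomb (nat ∘ a) W
  z≈aW = proj₂ (lattice-lincomb (ℤ.+_ ∘ a) w)
  z∈nΔ : dilate n (LatticePolytope w) (emb z)
  z∈nΔ = dilate-resp-≈ n (sym ∘ z≈aW) (lincomb∈dilate-ConvHull n 1≤n W (nat ∘ a) (nat-nonNeg ∘ a) Σa≡n)
  Σβ-a≡n : Σℚ β-a ≡ nat n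
  Σβ-a≡n = begin
    Σℚ β-a                       ≡⟨ Σℚ-distrib-- β (nat ∘ a) ⟩
    Σℚ β - Σℚ (nat ∘ a)          ≡⟨ cong₂ _-_ (trans Σβ≡2n (nat-homo-+ n n)) Σa≡n ⟩
    nat n + nat n - nat n        ≡⟨ solve 1 (λ ν → ν :+ ν :- ν := ν) refl (nat n) ⟩
    nat n                        ∎
    where open ≡-Reasoning
  β-a∈nΔ : dilate n (LatticePolytope w) (lincomb β-a W)
  β-a∈nΔ = lincomb∈dilate-ConvHull n 1≤n W β-a (p≤q⇒0≤q-p ∘ a≤β) Σβ-a≡n
  βW≈z+[β-a]W : lincomb β W ≈ (emb z ⊕ lincomb β-a W)
  βW≈z+[β-a]W t = begin
    lincomb β W t
      ≡⟨ solve 2 (λ b a → b := a :+ (b :- a)) refl (lincomb β W t) (emb z t) ⟩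
    emb z t + (lincomb β W t - emb z t)
      ≡⟨ cong (λ x → emb z t + (lincomb β W t - x)) (z≈aW t) ⟩
    emb z t + (lincomb β W t - lincomb (nat ∘ a) W t)
      ≡⟨ cong (emb z t +_) (lincomb-distrib-- β (nat ∘ a) W t) ⟨
    emb z t + lincomb β-a W t ∎
    where open ≡-Reasoning

simplex-split : ∀ {N k} n → 1 ≤ n → k ≤ n → (w : Fin (suc k) → LPt N) → ∀ {y} →
  LatticePolytope w y → LatticeSplit n (LatticePolytope w) (nat (n ℕ.+ n) • y)
simplex-split {k = k} n 1≤n k≤n w (c , c≥0 , Σc≡1 , y≈cW) =
  LatticeSplit-resp-≈ n (λ t → trans (lincomb-scale 2n c (emb ∘ w) t) (sym (cong (2n *_) (y≈cW t))))
    (lincomb∈LatticeSplit n 1≤n w α a a≤α Σα≡2n Σa≡n)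
  where
  2n = nat (n ℕ.+ n)
  α : Fin (suc k) → ℚ
  α i = 2n * c i
  Σα≡2n : Σℚ α ≡ 2n
  Σα≡2n = trans (sym (*-distribˡ-Σℚ 2n c)) (trans (cong (2n *_) Σc≡1) (ℚP.*-identityʳ 2n))
  k+n≤Σα : nat (k ℕ.+ n) ℚ.≤ Σℚ α
  k+n≤Σα = subst (nat (k ℕ.+ n) ℚ.≤_) (sym Σα≡2n) (nat-mono-≤ (ℕP.+-monoˡ-≤ n k≤n))
  rounded = round-down n α (λ i → *-nonNeg (nat-nonNeg (n ℕ.+ n)) (c≥0 i)) k+n≤Σα
  a = proj₁ rounded
  a≤α = proj₁ (proj₂ rounded)
  Σa≡n = proj₂ (proj₂ rounded)

doubleDilate⊆LatticeSplit : ∀ {N m} (v : Fin m → LPt N) n → 1 ≤ n → DimLE (LatticePolytope v) n →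
  ∀ x → dilate 2 (dilate n (LatticePolytope v)) x → LatticeSplit n (LatticePolytope v) x
doubleDilate⊆LatticeSplit v n 1≤n dim x (y′ , (y , y∈P , y′≈ny) , x≈2y′)
  with caratheodory (emb ∘ v) n dim y∈P
... | k , k≤n , σ , y∈Δ = LatticeSplit-resp-≈ n 2ny≈x
        (LatticeSplit-mono n (ConvHull-∘ (emb ∘ v) σ) (simplex-split n 1≤n k≤n (v ∘ σ) y∈Δ))
  where
  2ny≈x : (nat (n ℕ.+ n) • y) ≈ x
  2ny≈x t = sym (begin
    x t
      ≡⟨ x≈2y′ t ⟩
    nat 2 * y′ t
      ≡⟨ cong (nat 2 *_) (y′≈ny t) ⟩
    (1ℚ + 1ℚ) * (nat n * y t)
      ≡⟨ solve 2 (λ ν q → (con 1ℚ :+ con 1ℚ) :* (ν :* q) := (ν :+ ν) :* q) refl (nat n) (y t) ⟩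
    (nat n + nat n) * y t
      ≡⟨ cong (_* y t) (nat-homo-+ n n) ⟨
    nat (n ℕ.+ n) * y t ∎)
    where open ≡-Reasoning

LatticeSplit⊆doubleDilate : ∀ {N m} (p : Fin m → Pt N) n →
  ∀ x → LatticeSplit n (ConvHull p) x → dilate 2 (dilate n (ConvHull p)) x
LatticeSplit⊆doubleDilate p n x (a , b , (_ , (y₁ , y₁∈ , z≈ny₁) , a≈z) , (y₂ , y₂∈ , b≈ny₂) , x≈a+b) =
  nat n • y , (y , ConvHull-midpoint y₁∈ y₂∈ , λ _ → refl) , x≈2ny
  where
  y = lincomb (λ _ → ½) (y₁ ∷ y₂ ∷ [])
  x≈2ny : x ≈ (nat 2 • (nat n • y))
  x≈2ny t = begin
    x t
      ≡⟨ x≈a+b t ⟩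
    a t + b t
      ≡⟨ cong₂ _+_ (trans (a≈z t) (z≈ny₁ t)) (b≈ny₂ t) ⟩
    nat n * y₁ t + nat n * y₂ t
      ≡⟨ solve 3 (λ ν u w → ν :* u :+ ν :* w :=
                   (con 1ℚ :+ con 1ℚ) :* (ν :* (con ½ :* u :+ (con ½ :* w :+ con 0ℚ))))
                 refl (nat n) (y₁ t) (y₂ t) ⟩
    nat 2 * (nat n * y t) ∎
    where open ≡-Reasoning

lemma2p2 : ∀ {N m} (v : Fin m → LPt N) (n : ℕ) → 1 ≤ n →
    DimLE (LatticePolytope v) n →
    TwoConvexNormal (dilate n (LatticePolytope v))
lemma2p2 v n 1≤n dim = doubleDilate⊆LatticeSplit v n 1≤n dim , LatticeSplit⊆doubleDilate (emb ∘ v) n
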